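{- If a hypergraph $H$ is $\beta$-acyclic, then its separator hypergraph $\mathcal{S}(H)$ (with respect to any join tree of $H$) is $\beta$-acyclic, too.
   Context: A hypergraph has a finite vertex set and a family of nonempty hyperedges (distinct hyperedges may be equal as sets). A join tree for a hypergraph is a tree whose nodes are its hyperedges such that, for every vertex, the hyperedges containing it induce a connected subtree; a hypergraph is acyclic if it has one. A family of sets forms the hypergraph whose vertex set is its union and whose hyperedges are its members. A hypergraph is $\beta$-acyclic if every nonempty subfamily of its hyperedges forms an acyclic hypergraph. For a join tree $T$ of an acyclic $H$, the separator of an edge $E_iE_j$ of $T$ is $E_i\cap E_j$, and $\mathcal{S}(H)$ is the hypergraph formed by the family of all separators of edges of $T$. -}

module Defs where

open import Data.Nat using (ℕ; _∸_)
open import Data.Fin using (Fin)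
open import Data.Fin.Subset using (Subset; _∈_; _∩_; Nonempty)
open import Data.Fin.Subset.Properties using (nonempty?)
open import Data.List using (List; []; length; lookup; map; filter)
open import Data.List.Relation.Unary.All using (All)
open import Data.List.Membership.Propositional renaming (_∈_ to _∈ₗ_)
open import Data.List.Relation.Binary.Sublist.Propositional using () renaming (_⊆_ to _⊑_)
open import Data.Product using (_×_; _,_; proj₁; proj₂; ∃)
open import Data.Sum using (_⊎_)
open import Data.Unit using (⊤)
open import Relation.Binary.PropositionalEquality using (_≡_; _≢_)

-- A family of hyperedges over the vertex set Fin n (a multiset: a list).
Family : ℕ → Set
Family n = List (Subset n)

-- An (undirected) edge between nodes 0..m-1 of a graph.
Edge : ℕ → Set
Edge m = Fin m × Fin m

data Conn {m : ℕ} (es : List (Edge m)) (P : Fin m → Set) : Fin m → Fin m → Set where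
  stay : ∀ {i} → P i → Conn es P i i
  step : ∀ {i j k} → ((i , j) ∈ₗ es ⊎ (j , i) ∈ₗ es) → P i → Conn es P j k → Conn es P i k

IsTree : (m : ℕ) → List (Edge m) → Set
IsTree m es =
  All (λ e → proj₁ e ≢ proj₂ e) es
  × length es ≡ m ∸ 1
  × (∀ i j → Conn es (λ _ → ⊤) i j)

IsJoinTree : ∀ {n} (F : Family n) → List (Edge (length F)) → Set
IsJoinTree {n} F es =
  IsTree (length F) es
  × (∀ (v : Fin n) i j → v ∈ lookup F i → v ∈ lookup F j →
       Conn es (λ k → v ∈ lookup F k) i j)

Acyclic : ∀ {n} → Family n → Set
Acyclic F = ∃ λ es → IsJoinTree F es

BetaAcyclic : ∀ {n} → Family n → Set
BetaAcyclic F = ∀ G → G ⊑ F → G ≢ [] → Acyclic G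

-- The separator family of a join tree: E_i ∩ E_j for each tree edge E_i E_j,
-- keeping only the nonempty ones (hyperedges are nonempty).
separators : ∀ {n} (F : Family n) → List (Edge (length F)) → Family n
separators F es =
  filter nonempty? (map (λ e → lookup F (proj₁ e) ∩ lookup F (proj₂ e)) es)

{-# OPTIONS --safe #-}
module Submission where

-- We prove more: every family of hyperedges of H and separators of T, repetitions
-- allowed, is acyclic; induction is on the number of separators in the family.
-- Hyperedges alone are fine: the distinct ones form a subfamily of H, and a repeated
-- one is attached to its copy in the join tree.  For a separator E_a ∩ E_b, deleting
-- the edge ab from T splits the other members into those contained in a hyperedge on
-- a's side and those on b's side.  By induction the a-side together with E_b is
-- acyclic, and by the running intersection property everything E_b shares with the
-- a-side lies in E_a, so E_b can be shrunk to E_a ∩ E_b in its join tree.  The same on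
-- the b-side gives two join trees with the common node E_a ∩ E_b; they glue there,
-- because a vertex occurring on both sides lies in E_a ∩ E_b for the same reason.

open import Defs
open import Algebra.Bundles using (CommutativeMonoid)
import Algebra.Properties.CommutativeSemigroup as CommutativeSemigroupProperties
open import Data.Empty using (⊥-elim)
open import Data.Fin using (Fin; zero; suc; punchIn; punchOut; _≟_)
open import Data.Fin.Permutation using (Permutation; _⟨$⟩ʳ_; _⟨$⟩ˡ_; inverseˡ; inverseʳ; ↔⇒≡)
open import Data.Fin.Properties using (suc-injective; punchOut-cong; punchOut-punchIn; punchInᵢ≢i)
open import Data.Fin.Subset using (Subset; inside; outside; _∈_; _∉_; _∩_; _⊆_; Nonempty) renaming (⊥ to ∅)
open import Data.Fin.Subset.Properties using (_∈?_; x∈p∩q⁺; x∈p∩q⁻; p∩q⊆p; p∩q⊆q; ∩-comm; nonempty?)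
open import Data.List using (List; []; _∷_; _++_; length; map; lookup)
open import Data.List.Membership.Propositional using () renaming (_∈_ to _∈ₗ_)
open import Data.List.Membership.Propositional.Properties using (∈-map⁺; ∈-∃++; ∈-++⁺ˡ; ∈-++⁺ʳ; ∈-lookup)
open import Data.List.Properties
  using (length-map; length-++; length-++-≤ˡ; length-++-≤ʳ; map-∘; map-++; ++-identityʳ)
open import Data.List.Relation.Binary.Permutation.Homogeneous using (onIndices)
open import Data.List.Relation.Binary.Permutation.Propositional
  using (_↭_; ↭-refl; ↭-reflexive; ↭-prep; ↭-swap; ↭-sym; ↭-trans; ↭⇒↭ₛ; module PermutationReasoning)
open import Data.List.Relation.Binary.Permutation.Propositional.Properties
  using (∈-resp-↭; ↭-length; shift; ++⁺; ++⁺ˡ; ++-commutativeMonoid) renaming (map⁺ to ↭-map⁺)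
import Data.List.Relation.Binary.Permutation.Setoid.Properties as ↭ₛ
open import Data.List.Relation.Binary.Sublist.Propositional using ([]; _∷_; _∷ʳ_; ⊆-trans) renaming (_⊆_ to _⊑_)
open import Data.List.Relation.Binary.Sublist.Propositional.Properties using (filter-⊆)
open import Data.List.Relation.Unary.All using (All; []; _∷_)
import Data.List.Relation.Unary.All as All
import Data.List.Relation.Unary.All.Properties as All
open import Data.List.Relation.Unary.Any using (here; there)
open import Data.Nat using (ℕ; zero; suc; _≤_; _+_; _∸_; z≤n; s≤s)
open import Data.Nat.Properties using (1+n≰n; ≤-refl; ≤-trans; ≤-reflexive; module ≤-Reasoning)
open import Data.Product using (_×_; _,_; proj₁; proj₂; ∃; ∃₂)
import Data.Product as Product
open import Data.Sum using (_⊎_; inj₁; inj₂)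
import Data.Sum as Sum
open import Data.Unit using (⊤; tt)
open import Data.Vec using ([]; _∷_; _[_]≔_; here; there)
open import Function using (_∘_; id)
open import Relation.Binary.PropositionalEquality
  using (_≡_; _≢_; refl; sym; trans; cong; cong₂; subst; subst₂; setoid)
open import Relation.Nullary using (¬_; yes; no)

Adjacent : ∀ {m} → List (Edge m) → Fin m → Fin m → Set
Adjacent es i j = (i , j) ∈ₗ es ⊎ (j , i) ∈ₗ es

Reachable : ∀ {m} → List (Edge m) → Fin m → Fin m → Set
Reachable es = Conn es (λ _ → ⊤)

Connected : (m : ℕ) → List (Edge m) → Set
Connected m es = ∀ i j → Reachable es i j

module _ {m : ℕ} {es : List (Edge m)} {P : Fin m → Set} where

  walk-head : ∀ {i j} → Conn es P i j → P i
  walk-head (stay p)     = p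
  walk-head (step _ p _) = p

  walk-last : ∀ {i j} → Conn es P i j → P j
  walk-last (stay p)     = p
  walk-last (step _ _ w) = walk-last w

  infixr 5 _++ʷ_

  _++ʷ_ : ∀ {i j k} → Conn es P i j → Conn es P j k → Conn es P i k
  stay _     ++ʷ w = w
  step a p v ++ʷ w = step a p (v ++ʷ w)

  edge-walk : ∀ {i j} → Adjacent es i j → P i → P j → Conn es P i j
  edge-walk a p q = step a p (stay q)

  reverseʷ : ∀ {i j} → Conn es P i j → Conn es P j i
  reverseʷ (stay p)     = stay p
  reverseʷ (step a p w) = reverseʷ w ++ʷ edge-walk (Sum.swap a) (walk-head w) p

module _ {m m′ : ℕ} {es : List (Edge m)} {es′ : List (Edge m′)}
         {P : Fin m → Set} {Q : Fin m′ → Set} (g : Fin m → Fin m′) (pq : ∀ {k} → P k → Q (g k)) where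

  walk-map : (∀ {i j} → Adjacent es i j → P i → P j → Conn es′ Q (g i) (g j)) →
             ∀ {i j} → Conn es P i j → Conn es′ Q (g i) (g j)
  walk-map f (stay p)     = stay (pq p)
  walk-map f (step a p w) = f a p (walk-head w) ++ʷ walk-map f w

  walk-rename : (∀ {i j} → Adjacent es i j → Adjacent es′ (g i) (g j)) →
                ∀ {i j} → Conn es P i j → Conn es′ Q (g i) (g j)
  walk-rename adj = walk-map (λ a p q → edge-walk (adj a) (pq p) (pq q))

walk-weaken : ∀ {m} {es : List (Edge m)} {P Q : Fin m → Set} → (∀ {k} → P k → Q k) →
              ∀ {i j} → Conn es P i j → Conn es Q i j
walk-weaken pq = walk-rename id pq id

module _ {m : ℕ} {i j : Fin m} where

  Adjacent-map⁺ : ∀ {m′} {es} (g : Fin m → Fin m′) →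
                  Adjacent es i j → Adjacent (map (Product.map g g) es) (g i) (g j)
  Adjacent-map⁺ g = Sum.map (∈-map⁺ _) (∈-map⁺ _)

  Adjacent-resp-↭ : ∀ {es es′} → es ↭ es′ → Adjacent es i j → Adjacent es′ i j
  Adjacent-resp-↭ p = Sum.map (∈-resp-↭ p) (∈-resp-↭ p)

  Adjacent-++⁺ˡ : ∀ {es es′} → Adjacent es i j → Adjacent (es ++ es′) i j
  Adjacent-++⁺ˡ = Sum.map ∈-++⁺ˡ ∈-++⁺ˡ

  Adjacent-++⁺ʳ : ∀ es {es′} → Adjacent es′ i j → Adjacent (es ++ es′) i j
  Adjacent-++⁺ʳ es = Sum.map (∈-++⁺ʳ es) (∈-++⁺ʳ es)

  Adjacent-∷⁻ : ∀ {e es} → Adjacent (e ∷ es) i j → (i , j) ≡ e ⊎ (j , i) ≡ e ⊎ Adjacent es i j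
  Adjacent-∷⁻ (inj₁ (here eq))  = inj₁ eq
  Adjacent-∷⁻ (inj₂ (here eq))  = inj₂ (inj₁ eq)
  Adjacent-∷⁻ (inj₁ (there ij)) = inj₂ (inj₂ (inj₁ ij))
  Adjacent-∷⁻ (inj₂ (there ji)) = inj₂ (inj₂ (inj₂ ji))

∈-∃↭ : ∀ {A : Set} {x : A} {xs} → x ∈ₗ xs → ∃ λ ys → xs ↭ x ∷ ys
∈-∃↭ x∈xs with ys , zs , refl ← ∈-∃++ x∈xs = ys ++ zs , shift _ ys zs

Connected-resp-↭ : ∀ {m} {es es′ : List (Edge m)} → es ↭ es′ → Connected m es → Connected m es′
Connected-resp-↭ p conn i j = walk-rename id id (Adjacent-resp-↭ p) (conn i j)

edge-on-walk : ∀ {m} {es : List (Edge m)} {P} {i j} → Conn es P i j → i ≢ j →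
               ∃₂ λ x y → x ≢ y × (x , y) ∈ₗ es
edge-on-walk (stay _) i≢i = ⊥-elim (i≢i refl)
edge-on-walk {i = i} (step {j = j} a _ w) i≢k with i ≟ j | a
... | yes refl | _        = edge-on-walk w i≢k
... | no i≢j   | inj₁ ij∈ = i , j , i≢j , ij∈
... | no i≢j   | inj₂ ji∈ = j , i , i≢j ∘ sym , ji∈

module _ {n : ℕ} {x y : Fin (suc n)} (x≢y : x ≢ y) where

  contract : Fin (suc n) → Fin n
  contract z with y ≟ z
  ... | yes _   = punchOut (x≢y ∘ sym)
  ... | no y≢z = punchOut y≢z

  contract-merges : contract x ≡ contract y
  contract-merges with y ≟ x | y ≟ y
  ... | yes y≡x | _       = ⊥-elim (x≢y (sym y≡x))
  ... | no _    | yes _   = punchOut-cong y refl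
  ... | no _    | no y≢y = ⊥-elim (y≢y refl)

  contract-punchIn : ∀ u → contract (punchIn y u) ≡ u
  contract-punchIn u with y ≟ punchIn y u
  ... | yes y≡ = ⊥-elim (punchInᵢ≢i y u (sym y≡))
  ... | no _   = trans (punchOut-cong y refl) (punchOut-punchIn y)

  contract-connected : ∀ {es} → Connected (suc n) ((x , y) ∷ es) →
                       Connected n (map (Product.map contract contract) es)
  contract-connected {es} conn u w =
    subst₂ (Conn _ _) (contract-punchIn u) (contract-punchIn w)
           (walk-map contract id collapse (conn (punchIn y u) (punchIn y w)))
    where
    collapse : ∀ {i j} → Adjacent ((x , y) ∷ es) i j → ⊤ → ⊤ →
               Reachable (map (Product.map contract contract) es) (contract i) (contract j)
    collapse a _ _ with Adjacent-∷⁻ a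
    ... | inj₁ refl        = subst (Conn _ _ (contract x)) contract-merges (stay tt)
    ... | inj₂ (inj₁ refl) = subst (Conn _ _ (contract y)) (sym contract-merges) (stay tt)
    ... | inj₂ (inj₂ a′)   = edge-walk (Adjacent-map⁺ contract a′) tt tt

connected-suc-edges : ∀ k (es : List (Edge (suc k))) → Connected (suc k) es → k ≤ length es
connected-suc-edges zero    _  _    = z≤n
connected-suc-edges (suc k) es conn with edge-on-walk (conn zero (suc zero)) (λ ())
... | x , y , x≢y , xy∈es with ∈-∃↭ xy∈es
...   | es′ , es↭ = begin
  suc k                    ≤⟨ s≤s (connected-suc-edges k _ contracted) ⟩
  suc (length (map _ es′)) ≡⟨ cong suc (length-map _ es′) ⟩
  suc (length es′)         ≡⟨ ↭-length es↭ ⟨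
  length es                ∎
  where
  open ≤-Reasoning
  contracted : Connected (suc k) (map (Product.map (contract x≢y) (contract x≢y)) es′)
  contracted = contract-connected x≢y (Connected-resp-↭ es↭ conn)

connected-edges : ∀ {m} (es : List (Edge m)) → Connected m es → m ∸ 1 ≤ length es
connected-edges {zero}  _ _ = z≤n
connected-edges {suc k}     = connected-suc-edges k

module TreeEdge {m : ℕ} {T : List (Edge m)} (tree : IsTree m T) {a b : Fin m} (ab∈T : (a , b) ∈ₗ T) where

  T⁻ : List (Edge m)
  T⁻ = proj₁ (∈-∃↭ ab∈T)

  T↭ : T ↭ (a , b) ∷ T⁻
  T↭ = proj₂ (∈-∃↭ ab∈T)

  private
    size : length T ≡ m ∸ 1
    size = proj₁ (proj₂ tree)

    connected : Connected m T
    connected = proj₂ (proj₂ tree)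

  first-crossing : ∀ {P i j} → Conn T P i j →
                   Conn T⁻ P i j ⊎ (Conn T⁻ P i a × P b) ⊎ (Conn T⁻ P i b × P a)
  first-crossing (stay p) = inj₁ (stay p)
  first-crossing (step ij p w) with Adjacent-∷⁻ (Adjacent-resp-↭ T↭ ij)
  ... | inj₁ refl        = inj₂ (inj₁ (stay p , walk-head w))
  ... | inj₂ (inj₁ refl) = inj₂ (inj₂ (stay p , walk-head w))
  ... | inj₂ (inj₂ ij⁻)  =
    Sum.map (step ij⁻ p) (Sum.map (Product.map₁ (step ij⁻ p)) (Product.map₁ (step ij⁻ p))) (first-crossing w)

  endpoints-disconnected : ¬ Reachable T⁻ a b
  endpoints-disconnected ab = 1+n≰n (begin
    suc (length T⁻) ≡⟨ ↭-length T↭ ⟨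
    length T        ≡⟨ size ⟩
    m ∸ 1           ≤⟨ connected-edges T⁻ (λ i j → walk-map id id detour (connected i j)) ⟩
    length T⁻       ∎)
    where
    open ≤-Reasoning
    detour : ∀ {i j} → Adjacent T i j → ⊤ → ⊤ → Reachable T⁻ i j
    detour ij _ _ with Adjacent-∷⁻ (Adjacent-resp-↭ T↭ ij)
    ... | inj₁ refl        = ab
    ... | inj₂ (inj₁ refl) = reverseʷ ab
    ... | inj₂ (inj₂ ij⁻)  = edge-walk ij⁻ tt tt

  side : ∀ c → Reachable T⁻ c a ⊎ Reachable T⁻ c b
  side c with first-crossing (connected c a)
  ... | inj₁ w              = inj₁ w
  ... | inj₂ (inj₁ (w , _)) = inj₁ w
  ... | inj₂ (inj₂ (w , _)) = inj₂ w

  crossing : ∀ {P c d} → Reachable T⁻ c a → Reachable T⁻ d b → Conn T P c d → P a × P b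
  crossing ca db w with first-crossing w
  ... | inj₁ w⁻              = ⊥-elim (endpoints-disconnected (reverseʷ ca ++ʷ walk-weaken _ w⁻ ++ʷ db))
  ... | inj₂ (inj₁ (w⁻ , pb)) = walk-last w⁻ , pb
  ... | inj₂ (inj₂ (w⁻ , pa)) = pa , walk-last w⁻

module _ {A : Set} where

  leftIndex : ∀ (xs ys : List A) → Fin (length xs) → Fin (length (xs ++ ys))
  leftIndex (x ∷ xs) ys zero    = zero
  leftIndex (x ∷ xs) ys (suc i) = suc (leftIndex xs ys i)

  rightIndex : ∀ (xs ys : List A) → Fin (length ys) → Fin (length (xs ++ ys))
  rightIndex []       ys j = j
  rightIndex (x ∷ xs) ys j = suc (rightIndex xs ys j)

  lookup-leftIndex : ∀ xs ys i → lookup (xs ++ ys) (leftIndex xs ys i) ≡ lookup xs i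
  lookup-leftIndex (x ∷ xs) ys zero    = refl
  lookup-leftIndex (x ∷ xs) ys (suc i) = lookup-leftIndex xs ys i

  lookup-rightIndex : ∀ xs ys j → lookup (xs ++ ys) (rightIndex xs ys j) ≡ lookup ys j
  lookup-rightIndex []       ys j = refl
  lookup-rightIndex (x ∷ xs) ys j = lookup-rightIndex xs ys j

  leftIndex-injective : ∀ xs ys {i i′} → leftIndex xs ys i ≡ leftIndex xs ys i′ → i ≡ i′
  leftIndex-injective (x ∷ xs) ys {zero}  {zero}   _  = refl
  leftIndex-injective (x ∷ xs) ys {suc i} {suc i′} eq = cong suc (leftIndex-injective xs ys (suc-injective eq))

  rightIndex-injective : ∀ xs ys {j j′} → rightIndex xs ys j ≡ rightIndex xs ys j′ → j ≡ j′
  rightIndex-injective []       ys eq = eq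
  rightIndex-injective (x ∷ xs) ys eq = rightIndex-injective xs ys (suc-injective eq)

  data IndexView (xs ys : List A) : Fin (length (xs ++ ys)) → Set where
    inˡ : ∀ i → IndexView xs ys (leftIndex xs ys i)
    inʳ : ∀ j → IndexView xs ys (rightIndex xs ys j)

  indexView : ∀ xs ys k → IndexView xs ys k
  indexView []       ys k       = inʳ k
  indexView (x ∷ xs) ys zero    = inˡ zero
  indexView (x ∷ xs) ys (suc k) with indexView xs ys k
  ... | inˡ i = inˡ (suc i)
  ... | inʳ j = inʳ j

partition-⊎ : ∀ {A : Set} {P Q : A → Set} → (∀ x → P x ⊎ Q x) → ∀ xs →
              ∃₂ λ ys zs → All P ys × All Q zs × ys ++ zs ↭ xs
partition-⊎ P⊎Q []       = [] , [] , [] , [] , ↭-refl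
partition-⊎ P⊎Q (x ∷ xs) with partition-⊎ P⊎Q xs | P⊎Q x
... | ys , zs , Pys , Qzs , ↭xs | inj₁ px = x ∷ ys , zs , px ∷ Pys , Qzs , ↭-prep x ↭xs
... | ys , zs , Pys , Qzs , ↭xs | inj₂ qx =
  ys , x ∷ zs , Pys , qx ∷ Qzs , ↭-trans (shift x ys zs) (↭-prep x ↭xs)

⊑-map⇒lookups : ∀ {A B : Set} (f : A → B) (xs : List A) {ys} → ys ⊑ map f xs →
                ∃ λ (ks : List (Fin (length xs))) → ys ≡ map (f ∘ lookup xs) ks
⊑-map⇒lookups f []       []    = [] , refl
⊑-map⇒lookups f (x ∷ xs) (_ ∷ʳ ys⊑) with ks , refl ← ⊑-map⇒lookups f xs ys⊑ = map suc ks , map-∘ ks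
⊑-map⇒lookups f (x ∷ xs) (refl ∷ ys⊑) with ks , refl ← ⊑-map⇒lookups f xs ys⊑ =
  zero ∷ map suc ks , cong (f x ∷_) (map-∘ ks)

elements : ∀ {k} → Subset k → List (Fin k)
elements []            = []
elements (inside ∷ s)  = zero ∷ map suc (elements s)
elements (outside ∷ s) = map suc (elements s)

map-lookup-elements-⊑ : ∀ {A : Set} (xs : List A) s → map (lookup xs) (elements s) ⊑ xs
map-lookup-elements-⊑ []       []            = []
map-lookup-elements-⊑ (x ∷ xs) (inside ∷ s)  = refl ∷ subst (_⊑ xs) (map-∘ _) (map-lookup-elements-⊑ xs s)
map-lookup-elements-⊑ (x ∷ xs) (outside ∷ s) = x ∷ʳ subst (_⊑ xs) (map-∘ _) (map-lookup-elements-⊑ xs s)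

elements-∅ : ∀ k → elements (∅ {k}) ≡ []
elements-∅ zero    = refl
elements-∅ (suc k) = cong (map suc) (elements-∅ k)

∈-elements : ∀ {k} {x : Fin k} {s} → x ∈ s → x ∈ₗ elements s
∈-elements {s = inside ∷ _}  here        = here refl
∈-elements {s = inside ∷ _}  (there x∈s) = there (∈-map⁺ suc (∈-elements x∈s))
∈-elements {s = outside ∷ _} (there x∈s) = ∈-map⁺ suc (∈-elements x∈s)

elements-insert : ∀ {k} {x : Fin k} s → x ∉ s → elements (s [ x ]≔ inside) ↭ x ∷ elements s
elements-insert {x = zero}  (inside ∷ s)  x∉s = ⊥-elim (x∉s here)
elements-insert {x = zero}  (outside ∷ s) x∉s = ↭-refl
elements-insert {x = suc x} (inside ∷ s)  x∉s =
  ↭-trans (↭-prep zero (↭-map⁺ suc (elements-insert s (x∉s ∘ there)))) (↭-swap zero (suc x) ↭-refl)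
elements-insert {x = suc x} (outside ∷ s) x∉s = ↭-map⁺ suc (elements-insert s (x∉s ∘ there))

↭-repeats++elements : ∀ {k} (xs : List (Fin k)) →
                      ∃₂ λ (s : Subset k) ds → xs ↭ ds ++ elements s × All (_∈ₗ elements s) ds
↭-repeats++elements []       = ∅ , [] , ↭-reflexive (sym (elements-∅ _)) , []
↭-repeats++elements (x ∷ xs) with ↭-repeats++elements xs
... | s , ds , xs↭ , ds∈s with x ∈? s
...   | yes x∈s = s , x ∷ ds , ↭-prep x xs↭ , ∈-elements x∈s ∷ ds∈s
...   | no x∉s  = s [ x ]≔ inside , ds ,
                  ↭-trans (↭-prep x xs↭) (↭-trans (↭-sym (shift x ds _)) (++⁺ˡ ds (↭-sym inserted))) ,
                  All.map (∈-resp-↭ (↭-sym inserted) ∘ there) ds∈s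
  where
  inserted : elements (s [ x ]≔ inside) ↭ x ∷ elements s
  inserted = elements-insert s x∉s

module _ {n : ℕ} where

  acyclic-[] : Acyclic {n} []
  acyclic-[] = [] , ([] , refl , λ ()) , λ _ ()

  acyclic-twice : (x : Subset n) → Acyclic (x ∷ x ∷ [])
  acyclic-twice x = link ∷ [] , ((λ ()) ∷ [] , refl , λ i j → walk i j tt tt) , λ _ → walk
    where
    link : Edge 2
    link = zero , suc zero
    walk : ∀ {P : Fin 2 → Set} i j → P i → P j → Conn (link ∷ []) P i j
    walk zero       zero       p _ = stay p
    walk zero       (suc zero) p q = edge-walk (inj₁ (here refl)) p q
    walk (suc zero) zero       p q = edge-walk (inj₂ (here refl)) p q
    walk (suc zero) (suc zero) p _ = stay p

  acyclic-relabel : ∀ {F G : Family n} (π : Permutation (length F) (length G)) →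
                    (∀ i → lookup F i ≡ lookup G (π ⟨$⟩ʳ i)) → Acyclic F → Acyclic G
  acyclic-relabel {F} {G} π F≡G (es , (loopless , size , conn) , join) =
    map (Product.map to to) es , (loopless′ , size′ , conn′) , join′
    where
    to : Fin (length F) → Fin (length G)
    to = π ⟨$⟩ʳ_
    from : Fin (length G) → Fin (length F)
    from = π ⟨$⟩ˡ_
    to-injective : ∀ {i j} → to i ≡ to j → i ≡ j
    to-injective eq = trans (sym (inverseˡ π)) (trans (cong from eq) (inverseˡ π))
    move : ∀ {P Q} → (∀ {k} → P k → Q (to k)) → ∀ {i j} →
           Conn es P (from i) (from j) → Conn (map (Product.map to to) es) Q i j
    move pq w = subst₂ (Conn _ _) (inverseʳ π) (inverseʳ π) (walk-rename to pq (Adjacent-map⁺ to) w)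
    loopless′ : All (λ ij → proj₁ ij ≢ proj₂ ij) (map (Product.map to to) es)
    loopless′ = All.map⁺ (All.map (λ i≢j → i≢j ∘ to-injective) loopless)
    size′ : length (map (Product.map to to) es) ≡ length G ∸ 1
    size′ = trans (length-map _ es) (trans size (cong (_∸ 1) (↔⇒≡ π)))
    conn′ : Connected (length G) (map (Product.map to to) es)
    conn′ i j = move id (conn (from i) (from j))
    join′ : ∀ v i j → v ∈ lookup G i → v ∈ lookup G j → Conn _ (λ k → v ∈ lookup G k) i j
    join′ v i j vi vj = move (λ {k} → subst (v ∈_) (F≡G k)) (join v (from i) (from j) (pull vi) (pull vj))
      where
      pull : ∀ {k} → v ∈ lookup G k → v ∈ lookup F (from k)
      pull = subst (v ∈_) (sym (trans (F≡G _) (cong (lookup G) (inverseʳ π))))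

  acyclic-↭ : ∀ {F G : Family n} → F ↭ G → Acyclic F → Acyclic G
  acyclic-↭ {F} {G} F↭G =
    acyclic-relabel {F} {G} (onIndices (↭⇒↭ₛ F↭G)) (↭ₛ.onIndices-lookup (setoid _) (↭⇒↭ₛ F↭G))

  acyclic-glue : ∀ {e : Subset n} {X Y : Family n} → Acyclic (e ∷ X) → Acyclic (e ∷ Y) →
                 (∀ {x y} → x ∈ₗ X → y ∈ₗ Y → x ∩ y ⊆ e) → Acyclic (e ∷ X ++ Y)
  acyclic-glue {e} {X} {Y} (esˡ , (looplessˡ , sizeˡ , connˡ) , joinˡ)
                           (esʳ , (looplessʳ , sizeʳ , connʳ) , joinʳ) meet =
    es , (loopless , size , conn) , join
    where
    F : Family n
    F = e ∷ X ++ Y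

    L : Fin (suc (length X)) → Fin (length F)
    L = leftIndex (e ∷ X) Y

    R : Fin (suc (length Y)) → Fin (length F)
    R zero    = zero
    R (suc j) = rightIndex (e ∷ X) Y j

    R-injective : ∀ {j j′} → R j ≡ R j′ → j ≡ j′
    R-injective {zero}  {zero}   _  = refl
    R-injective {suc j} {suc j′} eq = cong suc (rightIndex-injective (e ∷ X) Y eq)

    lookup-R : ∀ j → lookup F (R j) ≡ lookup (e ∷ Y) j
    lookup-R zero    = refl
    lookup-R (suc j) = lookup-rightIndex (e ∷ X) Y j

    es : List (Edge (length F))
    es = map (Product.map L L) esˡ ++ map (Product.map R R) esʳ

    liftˡ : ∀ {P Q} → (∀ {k} → P k → Q (L k)) → ∀ {i j} → Conn esˡ P i j → Conn es Q (L i) (L j)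
    liftˡ pq = walk-rename L pq (Adjacent-++⁺ˡ ∘ Adjacent-map⁺ L)

    liftʳ : ∀ {P Q} → (∀ {k} → P k → Q (R k)) → ∀ {i j} → Conn esʳ P i j → Conn es Q (R i) (R j)
    liftʳ pq = walk-rename R pq (Adjacent-++⁺ʳ _ ∘ Adjacent-map⁺ R)

    loopless : All (λ ij → proj₁ ij ≢ proj₂ ij) es
    loopless = All.++⁺ (All.map⁺ (All.map (λ ne → ne ∘ leftIndex-injective (e ∷ X) Y) looplessˡ))
                       (All.map⁺ (All.map (λ ne → ne ∘ R-injective) looplessʳ))

    size : length es ≡ length F ∸ 1
    size = trans (length-++ (map _ esˡ))
                 (trans (cong₂ _+_ (trans (length-map _ esˡ) sizeˡ) (trans (length-map _ esʳ) sizeʳ))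
                        (sym (length-++ X)))

    to-root : ∀ k → Reachable es k zero
    to-root k with indexView (e ∷ X) Y k
    ... | inˡ i = liftˡ id (connˡ i zero)
    ... | inʳ j = liftʳ id (connʳ (suc j) zero)

    conn : Connected (length F) es
    conn k k′ = to-root k ++ʷ reverseʷ (to-root k′)

    module _ {v : Fin n} where

      outˡ : ∀ i → v ∈ lookup F (L i) → v ∈ lookup (e ∷ X) i
      outˡ i = subst (v ∈_) (lookup-leftIndex (e ∷ X) Y i)

      outʳ : ∀ j → v ∈ lookup F (R j) → v ∈ lookup (e ∷ Y) j
      outʳ j = subst (v ∈_) (lookup-R j)

      intoˡ : ∀ {i j} → Conn esˡ (λ k → v ∈ lookup (e ∷ X) k) i j →
              Conn es (λ k → v ∈ lookup F k) (L i) (L j)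
      intoˡ = liftˡ (λ {k} → subst (v ∈_) (sym (lookup-leftIndex (e ∷ X) Y k)))

      intoʳ : ∀ {i j} → Conn esʳ (λ k → v ∈ lookup (e ∷ Y) k) i j →
              Conn es (λ k → v ∈ lookup F k) (R i) (R j)
      intoʳ = liftʳ (λ {k} → subst (v ∈_) (sym (lookup-R k)))

      shared : ∀ i j → v ∈ lookup (e ∷ X) i → v ∈ lookup Y j → v ∈ e
      shared zero    _ ve _  = ve
      shared (suc i) j vx vy = meet (∈-lookup i) (∈-lookup j) (x∈p∩q⁺ (vx , vy))

    join : ∀ v k k′ → v ∈ lookup F k → v ∈ lookup F k′ → Conn es (λ l → v ∈ lookup F l) k k′
    join v k k′ vk vk′ with indexView (e ∷ X) Y k | indexView (e ∷ X) Y k′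
    ... | inˡ i | inˡ i′ = intoˡ (joinˡ v i i′ (outˡ i vk) (outˡ i′ vk′))
    ... | inʳ j | inʳ j′ = intoʳ (joinʳ v (suc j) (suc j′) (outʳ (suc j) vk) (outʳ (suc j′) vk′))
    ... | inˡ i | inʳ j  =
      intoˡ (joinˡ v i zero (outˡ i vk) ve) ++ʷ intoʳ (joinʳ v zero (suc j) ve (outʳ (suc j) vk′))
      where ve = shared i j (outˡ i vk) (outʳ (suc j) vk′)
    ... | inʳ j | inˡ i  =
      intoʳ (joinʳ v (suc j) zero (outʳ (suc j) vk) ve) ++ʷ intoˡ (joinˡ v zero i ve (outˡ i vk′))
      where ve = shared i j (outˡ i vk′) (outʳ (suc j) vk)

  acyclic-shrink : ∀ {x y : Subset n} {X : Family n} → Acyclic (x ∷ X) → y ⊆ x →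
                   (∀ {z} → z ∈ₗ X → x ∩ z ⊆ y) → Acyclic (y ∷ X)
  acyclic-shrink {x} {y} {X} (es , tree , join) y⊆x guard = es , tree , join′
    where
    widen : ∀ {v} k → v ∈ lookup (y ∷ X) k → v ∈ lookup (x ∷ X) k
    widen zero    = y⊆x
    widen (suc _) = id

    narrow : ∀ {v} i → v ∈ lookup X i → ∀ {k} → v ∈ lookup (x ∷ X) k → v ∈ lookup (y ∷ X) k
    narrow i vz {zero}  vx = guard (∈-lookup i) (x∈p∩q⁺ (vx , vz))
    narrow i vz {suc _} vk = vk

    join′ : ∀ v i j → v ∈ lookup (y ∷ X) i → v ∈ lookup (y ∷ X) j →
            Conn es (λ k → v ∈ lookup (y ∷ X) k) i j
    join′ v zero    zero    vy _  = stay vy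
    join′ v (suc i) j       vi vj = walk-weaken (λ {k} → narrow i vi {k}) (join v (suc i) j vi (widen j vj))
    join′ v zero    (suc j) vy vj = walk-weaken (λ {k} → narrow j vj {k}) (join v zero (suc j) (y⊆x vy) vj)

  acyclic-∷-duplicate : ∀ {x : Subset n} {X : Family n} → x ∈ₗ X → Acyclic X → Acyclic (x ∷ X)
  acyclic-∷-duplicate {x} x∈X acyclic with X′ , X↭ ← ∈-∃↭ x∈X =
    acyclic-↭ (↭-prep x (↭-sym X↭)) (acyclic-glue (acyclic-twice x) (acyclic-↭ X↭ acyclic) meet)
    where
    meet : ∀ {y z} → y ∈ₗ x ∷ [] → z ∈ₗ X′ → y ∩ z ⊆ x
    meet (here refl) _ = proj₁ ∘ x∈p∩q⁻ _ _

  acyclic-++-duplicates : ∀ {X Y : Family n} → All (_∈ₗ X) Y → Acyclic X → Acyclic (Y ++ X)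
  acyclic-++-duplicates []                  acyclic = acyclic
  acyclic-++-duplicates {Y = _ ∷ Y} (y∈X ∷ Y⊆X) acyclic =
    acyclic-∷-duplicate (∈-++⁺ʳ Y y∈X) (acyclic-++-duplicates Y⊆X acyclic)

module _ {n : ℕ} {F : Family n} (βF : BetaAcyclic F) {T : List (Edge (length F))} (jt : IsJoinTree F T) where

  E : Fin (length F) → Subset n
  E = lookup F

  S : Fin (length T) → Subset n
  S k = E (proj₁ (lookup T k)) ∩ E (proj₂ (lookup T k))

  Mixed : List (Fin (length T)) → List (Fin (length F)) → Family n
  Mixed ks xs = map S ks ++ map E xs

  subfamily-acyclic : ∀ G → G ⊑ F → Acyclic G
  subfamily-acyclic []      _   = acyclic-[]
  subfamily-acyclic (g ∷ G) G⊑F = βF (g ∷ G) G⊑F (λ ())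

  hyperedges-acyclic : ∀ xs → Acyclic (map E xs)
  hyperedges-acyclic xs with s , ds , xs↭ , ds∈s ← ↭-repeats++elements xs =
    acyclic-↭ (↭-map⁺ E (↭-sym xs↭)) (subst Acyclic (sym (map-++ E ds (elements s)))
      (acyclic-++-duplicates (All.map⁺ (All.map (∈-map⁺ E) ds∈s))
                             (subfamily-acyclic _ (map-lookup-elements-⊑ F s))))

  Mixed-↭ : ∀ ksᴬ ksᴮ xsᴬ xsᴮ {ks xs} → ksᴬ ++ ksᴮ ↭ ks → xsᴬ ++ xsᴮ ↭ xs →
            Mixed ksᴬ xsᴬ ++ Mixed ksᴮ xsᴮ ↭ Mixed ks xs
  Mixed-↭ ksᴬ ksᴮ xsᴬ xsᴮ {ks} {xs} ks↭ xs↭ = begin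
    (map S ksᴬ ++ map E xsᴬ) ++ (map S ksᴮ ++ map E xsᴮ)
      ↭⟨ interchange (map S ksᴬ) _ _ _ ⟩
    (map S ksᴬ ++ map S ksᴮ) ++ (map E xsᴬ ++ map E xsᴮ)
      ≡⟨ cong₂ _++_ (map-++ S ksᴬ ksᴮ) (map-++ E xsᴬ xsᴮ) ⟨
    map S (ksᴬ ++ ksᴮ) ++ map E (xsᴬ ++ xsᴮ)
      ↭⟨ ++⁺ (↭-map⁺ S ks↭) (↭-map⁺ E xs↭) ⟩
    map S ks ++ map E xs
      ∎
    where
    open PermutationReasoning
    open CommutativeSemigroupProperties
           (CommutativeMonoid.commutativeSemigroup (++-commutativeMonoid {A = Subset n})) using (interchange)

  module Separation {a b : Fin (length F)} (ab∈T : (a , b) ∈ₗ T) where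
    open TreeEdge (proj₁ jt) ab∈T public

    OnSide : Fin (length F) → Subset n → Set
    OnSide u z = ∃ λ c → Reachable T⁻ c u × z ⊆ E c

    separates : ∀ {z w} → OnSide a z → OnSide b w → z ∩ w ⊆ E a ∩ E b
    separates (c , ca , z⊆c) (d , db , w⊆d) v∈z∩w with vz , vw ← x∈p∩q⁻ _ _ v∈z∩w =
      x∈p∩q⁺ (crossing ca db (proj₂ jt _ c d (z⊆c vz) (w⊆d vw)))

    onSide-separators : ∀ {u ks} → All (λ k → Reachable T⁻ (proj₁ (lookup T k)) u) ks →
                        All (OnSide u) (map S ks)
    onSide-separators = All.map⁺ ∘ All.map (λ w → _ , w , λ {v} → p∩q⊆p _ _ {v})

    onSide-hyperedges : ∀ {u xs} → All (λ c → Reachable T⁻ c u) xs → All (OnSide u) (map E xs)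
    onSide-hyperedges = All.map⁺ ∘ All.map (λ w → _ , w , λ {v} v∈ → v∈)

  module _ (k : Fin (length T)) where
    private
      a b : Fin (length F)
      a = proj₁ (lookup T k)
      b = proj₂ (lookup T k)
    open Separation {a} {b} (∈-lookup k)

    acyclic-∷-separator : ∀ ks xs → (∀ ks′ xs′ → length ks′ ≤ length ks → Acyclic (Mixed ks′ xs′)) →
                          Acyclic (S k ∷ Mixed ks xs)
    acyclic-∷-separator ks xs ih
      with partition-⊎ (side ∘ proj₁ ∘ lookup T) ks | partition-⊎ side xs
    ... | ksᴬ , ksᴮ , ksᴬ-reach , ksᴮ-reach , ks↭ | xsᴬ , xsᴮ , xsᴬ-reach , xsᴮ-reach , xs↭ =
      acyclic-↭ (↭-prep (S k) (Mixed-↭ ksᴬ ksᴮ xsᴬ xsᴮ ks↭ xs↭))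
        (acyclic-glue sideᴬ sideᴮ λ z∈ w∈ → separates (All.lookup onSideᴬ z∈) (All.lookup onSideᴮ w∈))
      where
      onSideᴬ : All (OnSide a) (Mixed ksᴬ xsᴬ)
      onSideᴬ = All.++⁺ (onSide-separators ksᴬ-reach) (onSide-hyperedges xsᴬ-reach)

      onSideᴮ : All (OnSide b) (Mixed ksᴮ xsᴮ)
      onSideᴮ = All.++⁺ (onSide-separators ksᴮ-reach) (onSide-hyperedges xsᴮ-reach)

      sideᴬ : Acyclic (S k ∷ Mixed ksᴬ xsᴬ)
      sideᴬ = acyclic-shrink
        (acyclic-↭ (shift (E b) (map S ksᴬ) _)
                   (ih ksᴬ (b ∷ xsᴬ) (≤-trans (length-++-≤ˡ ksᴬ) (≤-reflexive (↭-length ks↭)))))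
        (λ {v} → p∩q⊆q _ _ {v})
        (λ z∈ → subst (_⊆ S k) (∩-comm _ _) (separates (All.lookup onSideᴬ z∈) (b , stay tt , λ v∈ → v∈)))

      sideᴮ : Acyclic (S k ∷ Mixed ksᴮ xsᴮ)
      sideᴮ = acyclic-shrink
        (acyclic-↭ (shift (E a) (map S ksᴮ) _)
                   (ih ksᴮ (a ∷ xsᴮ) (≤-trans (length-++-≤ʳ ksᴮ {ksᴬ}) (≤-reflexive (↭-length ks↭)))))
        (λ {v} → p∩q⊆p _ _ {v})
        (λ z∈ → separates (a , stay tt , λ v∈ → v∈) (All.lookup onSideᴮ z∈))

  mixed-acyclic : ∀ c ks xs → length ks ≤ c → Acyclic (Mixed ks xs)
  mixed-acyclic _       []       xs _          = hyperedges-acyclic xs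
  mixed-acyclic (suc c) (k ∷ ks) xs (s≤s ks≤c) =
    acyclic-∷-separator k ks xs (λ ks′ xs′ ks′≤ks → mixed-acyclic c ks′ xs′ (≤-trans ks′≤ks ks≤c))

  separators-acyclic : ∀ ks → Acyclic (map S ks)
  separators-acyclic ks = subst Acyclic (++-identityʳ (map S ks)) (mixed-acyclic _ ks [] ≤-refl)

lemma9 : (n : ℕ) (F : Family n) → All Nonempty F → BetaAcyclic F →
         (T : List (Edge (length F))) → IsJoinTree F T →
         BetaAcyclic (separators F T)
lemma9 n F _ βF T jt G G⊑ _ with ks , refl ← ⊑-map⇒lookups _ T (⊆-trans G⊑ (filter-⊆ nonempty? _)) =
  separators-acyclic βF jt ks
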